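{- Let $G$ and $H$ be finite simple undirected graphs with $k=\chi(G^2)$ and $n=|V(H)|$. Then $$\chi_o^+(G[H])\le k\,(n+2^n)^{k-1}\,\chi_o^+(H).$$
   Context: An oriented graph is a digraph with no loops, no multiple arcs and no pair of opposite arcs; an orientation of an undirected graph gives each edge one of its two directions. A homomorphism between oriented graphs is a vertex map sending arcs to arcs. The upper oriented chromatic number $\chi_o^+(G)$ is the smallest order of an oriented graph $\vec T$ such that every orientation of $G$ admits a homomorphism to $\vec T$. The square $G^2$ has vertex set $V(G)$, with $u,v$ adjacent iff their distance in $G$ is 1 or 2; $\chi$ is the chromatic number. The lexicographic product $G[H]$ has vertex set $V(G)\times V(H)$, and $\{[u,v],[u',v']\}$ is an edge iff either $\{u,u'\}\in E(G)$, or $u=u'$ and $\{v,v'\}\in E(H)$. -}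

module Defs where

open import Data.Nat using (ℕ; _<_)
open import Data.Fin using (Fin; _≟_; remQuot)
open import Data.Bool.Properties using (∧-comm; ∨-comm)
open import Relation.Nullary using (yes; no)
open import Relation.Binary.PropositionalEquality using (refl; cong; cong₂; trans) renaming (sym to ≡-sym)
open import Data.Nat using (_*_)
open import Data.Bool using (Bool; true; false; T; _∨_; _∧_; not)
open import Data.Product using (_×_; _,_; Σ; ∃; ∃-syntax)
open import Data.Sum using (_⊎_)
open import Data.Empty using (⊥-elim)
open import Relation.Nullary using (¬_; does)
open import Relation.Binary.PropositionalEquality using (_≡_)

record Graph (v : ℕ) : Set where
  field
    adj   : Fin v → Fin v → Bool
    sym   : ∀ x y → adj x y ≡ adj y x
    irrefl : ∀ x → adj x x ≡ false
open Graph public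

Colourable : ∀ {v} → Graph v → ℕ → Set
Colourable {v} G c = Σ (Fin v → Fin c) λ f → ∀ x y → T (adj G x y) → ¬ (f x ≡ f y)

IsChromaticNumber : ∀ {v} → Graph v → ℕ → Set
IsChromaticNumber G k = Colourable G k × (∀ c → c < k → ¬ Colourable G c)

anyFin : ∀ {m} → (Fin m → Bool) → Bool
anyFin {ℕ.zero} p = false
anyFin {ℕ.suc m} p = p Fin.zero ∨ anyFin (λ i → p (Fin.suc i))

anyFin-ext : ∀ {m} (p q : Fin m → Bool) → (∀ i → p i ≡ q i) → anyFin p ≡ anyFin q
anyFin-ext {ℕ.zero} p q e = refl
anyFin-ext {ℕ.suc m} p q e = cong₂ _∨_ (e Fin.zero) (anyFin-ext _ _ (λ i → e (Fin.suc i)))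

neq : ∀ {v} → Fin v → Fin v → Bool
neq x y = not (does (x ≟ y))

neq-sym : ∀ {v} (x y : Fin v) → neq x y ≡ neq y x
neq-sym x y with x ≟ y | y ≟ x
... | yes _ | yes _ = refl
... | no _ | no _ = refl
... | yes p | no q = ⊥-elim (q (≡-sym p))
... | no p | yes q = ⊥-elim (p (≡-sym q))

neq-refl : ∀ {v} (x : Fin v) → neq x x ≡ false
neq-refl x with x ≟ x
... | yes _ = refl
... | no p = ⊥-elim (p refl)

sq-adj : ∀ {v} → Graph v → Fin v → Fin v → Bool
sq-adj G x y = neq x y ∧ (adj G x y ∨ anyFin (λ z → adj G x z ∧ adj G z y))

square : ∀ {v} → Graph v → Graph v
square G = record
  { adj = sq-adj G
  ; sym = λ x y → cong₂ _∧_ (neq-sym x y)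
      (cong₂ _∨_ (Graph.sym G x y)
        (anyFin-ext _ _ (λ z → trans (∧-comm (adj G x z) (adj G z y))
                                 (cong₂ _∧_ (Graph.sym G z y) (Graph.sym G x z)))))
  ; irrefl = λ x → cong (_∧ (adj G x x ∨ anyFin (λ z → adj G x z ∧ adj G z x))) (neq-refl x)
  }

-- Lexicographic product G[H] on Fin (a * b); vertex i corresponds to the pair
-- remQuot b i = (u , w) ∈ V(G) × V(H).  [u,w] ~ [u',w'] iff u ~_G u', or
-- u = u' and w ~_H w'.
lex-adj' : ∀ {a b} → Graph a → Graph b → Fin a × Fin b → Fin a × Fin b → Bool
lex-adj' G H (u , w) (u' , w') = adj G u u' ∨ (not (neq u u') ∧ adj H w w')

lex-sym' : ∀ {a b} (G : Graph a) (H : Graph b) p q → lex-adj' G H p q ≡ lex-adj' G H q p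
lex-sym' G H (u , w) (u' , w') =
  cong₂ _∨_ (Graph.sym G u u') (cong₂ _∧_ (cong not (neq-sym u u')) (Graph.sym H w w'))

lex-irrefl' : ∀ {a b} (G : Graph a) (H : Graph b) p → lex-adj' G H p p ≡ false
lex-irrefl' G H (u , w) rewrite Graph.irrefl G u | Graph.irrefl H w | neq-refl u = refl

lex : ∀ {a b} → Graph a → Graph b → Graph (a * b)
lex {a} {b} G H = record
  { adj = λ i j → lex-adj' G H (remQuot b i) (remQuot b j)
  ; sym = λ i j → lex-sym' G H (remQuot b i) (remQuot b j)
  ; irrefl = λ i → lex-irrefl' G H (remQuot b i)
  }

record OrientedGraph (m : ℕ) : Set where
  field
    arc    : Fin m → Fin m → Bool
    loopless : ∀ x → arc x x ≡ false
    asym   : ∀ x y → T (arc x y) → arc y x ≡ false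
open OrientedGraph public

record Orientation {v : ℕ} (G : Graph v) : Set where
  field
    dir      : OrientedGraph v
    arc⇒edge : ∀ x y → T (arc dir x y) → T (adj G x y)
    edge⇒arc : ∀ x y → T (adj G x y) → T (arc dir x y) ⊎ T (arc dir y x)
open Orientation public

Hom : ∀ {v m} → OrientedGraph v → OrientedGraph m → Set
Hom {v} {m} D E = Σ (Fin v → Fin m) λ f → ∀ x y → T (arc D x y) → T (arc E (f x) (f y))

-- χ_o^+(G) ≤ m : some oriented graph of order m receives every orientation of G.
UpperOrientedColourable : ∀ {v} → Graph v → ℕ → Set
UpperOrientedColourable G m =
  Σ (OrientedGraph m) λ Tg → (O : Orientation G) → Hom (dir O) Tg

IsUpperOrientedChromaticNumber : ∀ {v} → Graph v → ℕ → Set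
IsUpperOrientedChromaticNumber G c =
  UpperOrientedColourable G c × (∀ c' → c' < c → ¬ UpperOrientedColourable G c')

module Submission where

-- Colour G² properly with k colours, so that every vertex has at most one
-- G-neighbour of each colour.  A vertex (u , w) of G[H] receives the colour of
-- u, a colour of w in a fixed target for H (applied to the copy of H over u),
-- and, for every other colour j, a slot: the vertex w itself if j is below the
-- colour of u, and otherwise the set of w' with (u , w) → (v , w'), where v is
-- the neighbour of u of colour j.  Between two adjacent fibres exactly one
-- endpoint stores a vertex and the other a set, and the arc between them is
-- read off from membership.  There are k choices of colour, n + 2ⁿ per slot
-- and χ_o⁺(H) for the H-part.

open import Defs
open import Data.Bool using (Bool; false; T; not; T?)
open import Data.Bool.Properties using (T-∧; T-∨; T-≡; T-not-≡)
open import Data.Empty using (⊥-elim)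
open import Data.Fin using (Fin; _≟_; _<_; combine; remQuot; join; splitAt;
  punchIn; punchOut; finToFun; funToFin)
open import Data.Fin.Properties using (¬Fin0; 2↔Bool; _<?_; <-cmp; any?; remQuot-combine;
  combine-remQuot; splitAt-join; punchIn-punchOut; punchOut-cong; finToFun-funToFin)
open import Data.Nat using (ℕ; _*_; _+_; _^_; _∸_; _≤_)
open import Data.Nat.Properties using (≮⇒≥)
open import Data.Product using (_×_; _,_; proj₁; proj₂; ∃; map₁; uncurry)
open import Data.Sum using (_⊎_; inj₁; inj₂)
open import Function using (_∘_; const)
open import Function.Bundles using (Inverse; Equivalence)
open import Relation.Binary.Definitions using (tri<; tri≈; tri>)
open import Relation.Binary.PropositionalEquality
  using (_≡_; _≢_; ≢-sym; refl; cong; cong₂; trans; subst; subst₂; module ≡-Reasoning)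
  renaming (sym to ≡-sym)
open import Relation.Nullary using (¬_; Dec; yes; no)
open import Relation.Nullary.Decidable using (_×-dec_)

ProperColouring : ∀ {v k} → Graph v → (Fin v → Fin k) → Set
ProperColouring G c = ∀ x y → T (adj G x y) → c x ≢ c y

T-neq : ∀ {v} {x y : Fin v} → x ≢ y → T (neq x y)
T-neq {x = x} {y} x≢y with x ≟ y
... | yes x≡y = x≢y x≡y
... | no _ = _

T-not-neq : ∀ {v} {x y : Fin v} → T (not (neq x y)) → x ≡ y
T-not-neq {x = x} {y} with x ≟ y
... | yes x≡y = const x≡y
... | no _ = λ ()

anyFin-intro : ∀ {m} (p : Fin m → Bool) z → T (p z) → T (anyFin p)
anyFin-intro p Fin.zero pz = Equivalence.from T-∨ (inj₁ pz)
anyFin-intro p (Fin.suc z) pz = Equivalence.from T-∨ (inj₂ (anyFin-intro (p ∘ Fin.suc) z pz))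

module _ {a} (G : Graph a) where

  adj⇒≢ : ∀ {x y} → T (adj G x y) → x ≢ y
  adj⇒≢ {x} x~y refl = subst T (irrefl G x) x~y

  module _ {k} {c : Fin a → Fin k} (c-proper : ProperColouring (square G) c) where

    square-proper⇒proper : ∀ {x y} → T (adj G x y) → c x ≢ c y
    square-proper⇒proper {x} {y} x~y =
      c-proper x y (Equivalence.from T-∧
        (T-neq (adj⇒≢ x~y) , Equivalence.from T-∨ (inj₁ x~y)))

    square-proper⇒neighbours-distinct : ∀ {u v v'} → T (adj G u v) → T (adj G u v') →
      c v ≡ c v' → v ≡ v'
    square-proper⇒neighbours-distinct {u} {v} {v'} u~v u~v' cv≡cv' with v ≟ v'
    ... | yes v≡v' = v≡v'
    ... | no v≢v' = ⊥-elim (c-proper v v' v≈v' cv≡cv')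
      where
      v≈v' : T (sq-adj G v v')
      v≈v' = Equivalence.from T-∧ (T-neq v≢v' , Equivalence.from T-∨ (inj₂
        (anyFin-intro _ u (Equivalence.from T-∧ (subst T (sym G u v) u~v , u~v')))))

module _ {a n} (G : Graph a) (H : Graph n) where

  lex-adj-combine : ∀ u w v w' →
    adj (lex G H) (combine u w) (combine v w') ≡ lex-adj' G H (u , w) (v , w')
  lex-adj-combine u w v w' = cong₂ (lex-adj' G H) (remQuot-combine u w) (remQuot-combine v w')

  lex-adj'-fibre : ∀ u w w' → lex-adj' G H (u , w) (u , w') ≡ adj H w w'
  lex-adj'-fibre u w w' rewrite irrefl G u | neq-refl u = refl

  lex-adj'⇒adj⊎≡ : ∀ {u w v w'} → T (lex-adj' G H (u , w) (v , w')) → T (adj G u v) ⊎ u ≡ v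
  lex-adj'⇒adj⊎≡ e with Equivalence.to T-∨ e
  ... | inj₁ u~v = inj₁ u~v
  ... | inj₂ same = inj₂ (T-not-neq (proj₁ (Equivalence.to T-∧ same)))

  fibre : Orientation (lex G H) → Fin a → Orientation H
  fibre O u = record
    { dir = record
      { arc = λ w w' → arc (dir O) (combine u w) (combine u w')
      ; loopless = λ w → loopless (dir O) _
      ; asym = λ w w' → asym (dir O) _ _
      }
    ; arc⇒edge = λ w w' a → subst T (adj-fibre w w') (arc⇒edge O _ _ a)
    ; edge⇒arc = λ w w' e → edge⇒arc O _ _ (subst T (≡-sym (adj-fibre w w')) e)
    }
    where
    adj-fibre : ∀ w w' → adj (lex G H) (combine u w) (combine u w') ≡ adj H w w'
    adj-fibre w w' = trans (lex-adj-combine u w u w') (lex-adj'-fibre u w w')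

emptyOrientedGraph : OrientedGraph 0
emptyOrientedGraph = record { arc = λ () ; loopless = λ () ; asym = λ () }

vertexless⇒upperOrientedColourable : ∀ {v} (G : Graph v) → (Fin v → Fin 0) →
  UpperOrientedColourable G 0
vertexless⇒upperOrientedColourable G f =
  emptyOrientedGraph , λ O → f , λ x _ _ → ⊥-elim (¬Fin0 (f x))

-- Subsets of Fin n, coded as elements of Fin (2 ^ n).

_∈ᶜ_ : ∀ {n} → Fin n → Fin (2 ^ n) → Bool
w ∈ᶜ r = Inverse.to 2↔Bool (finToFun r w)

encodeSubset : ∀ {n} → (Fin n → Bool) → Fin (2 ^ n)
encodeSubset p = funToFin (Inverse.from 2↔Bool ∘ p)

∈ᶜ-encodeSubset : ∀ {n} (p : Fin n → Bool) w → w ∈ᶜ encodeSubset p ≡ p w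
∈ᶜ-encodeSubset p w = trans (cong (Inverse.to 2↔Bool) (finToFun-funToFin _ w))
                            (Inverse.strictlyInverseˡ 2↔Bool (p w))

Slot : ℕ → Set
Slot n = Fin n ⊎ Fin (2 ^ n)

cross : ∀ {n} → Slot n → Slot n → Bool
cross (inj₂ r) (inj₁ w) = w ∈ᶜ r
cross (inj₁ w) (inj₂ r) = not (w ∈ᶜ r)
cross _ _ = false

cross-asym : ∀ {n} (s s' : Slot n) → T (cross s s') → cross s' s ≡ false
cross-asym (inj₂ r) (inj₁ w) w∈r = cong not (Equivalence.to T-≡ w∈r)
cross-asym (inj₁ w) (inj₂ r) w∉r = Equivalence.to T-not-≡ w∉r

module Target {k n cH : ℕ} (TH : OrientedGraph cH) where

  Colour : Set
  Colour = (Fin (ℕ.suc k) × Fin ((n + 2 ^ n) ^ k)) × Fin cH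

  slotFor : {i j : Fin (ℕ.suc k)} → i ≢ j → Fin ((n + 2 ^ n) ^ k) → Slot n
  slotFor i≢j s = splitAt n (finToFun s (punchOut i≢j))

  slotFor-irrelevant : ∀ {i j} (p q : i ≢ j) s → slotFor p s ≡ slotFor q s
  slotFor-irrelevant {i} p q s = cong (splitAt n ∘ finToFun s) (punchOut-cong i refl)

  colourArcWith : ∀ {i j : Fin (ℕ.suc k)} → Dec (i ≡ j) →
    Fin ((n + 2 ^ n) ^ k) → Fin ((n + 2 ^ n) ^ k) → Fin cH → Fin cH → Bool
  colourArcWith (yes _) s s' t t' = arc TH t t'
  colourArcWith (no i≢j) s s' t t' = cross (slotFor i≢j s) (slotFor (≢-sym i≢j) s')

  colourArc : Colour → Colour → Bool
  colourArc ((i , s) , t) ((j , s') , t') = colourArcWith (i ≟ j) s s' t t'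

  colourArc-same : ∀ i s s' t t' → colourArc ((i , s) , t) ((i , s') , t') ≡ arc TH t t'
  colourArc-same i s s' t t' with i ≟ i
  ... | yes _ = refl
  ... | no i≢i = ⊥-elim (i≢i refl)

  colourArc-distinct : ∀ {i j} (i≢j : i ≢ j) (j≢i : j ≢ i) s s' t t' →
    colourArc ((i , s) , t) ((j , s') , t') ≡ cross (slotFor i≢j s) (slotFor j≢i s')
  colourArc-distinct {i} {j} i≢j j≢i s s' t t' with i ≟ j
  ... | yes i≡j = ⊥-elim (i≢j i≡j)
  ... | no i≢j′ =
    cong₂ cross (slotFor-irrelevant i≢j′ i≢j s) (slotFor-irrelevant _ j≢i s')

  colourArc-loopless : ∀ x → colourArc x x ≡ false
  colourArc-loopless ((i , s) , t) = trans (colourArc-same i s s t t) (loopless TH t)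

  colourArc-asym : ∀ x y → T (colourArc x y) → colourArc y x ≡ false
  colourArc-asym ((i , s) , t) ((j , s') , t') x→y with i ≟ j
  ... | yes refl = trans (colourArc-same i s' s t' t) (asym TH t t' x→y)
  ... | no i≢j = trans (colourArc-distinct (≢-sym i≢j) i≢j s' s t' t)
                       (cross-asym (slotFor i≢j s) _ x→y)

  unpack : Fin (ℕ.suc k * (n + 2 ^ n) ^ k * cH) → Colour
  unpack x = map₁ (remQuot ((n + 2 ^ n) ^ k)) (remQuot cH x)

  pack : Colour → Fin (ℕ.suc k * (n + 2 ^ n) ^ k * cH)
  pack ((i , s) , t) = combine (combine i s) t

  unpack-pack : ∀ x → unpack (pack x) ≡ x
  unpack-pack ((i , s) , t) =
    trans (cong (map₁ (remQuot ((n + 2 ^ n) ^ k))) (remQuot-combine (combine i s) t))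
          (cong (_, t) (remQuot-combine i s))

  target : OrientedGraph (ℕ.suc k * (n + 2 ^ n) ^ k * cH)
  target = record
    { arc = λ x y → colourArc (unpack x) (unpack y)
    ; loopless = colourArc-loopless ∘ unpack
    ; asym = λ x y → colourArc-asym (unpack x) (unpack y)
    }

  hom-target : ∀ {v} {D : OrientedGraph v} (f : Fin v → Colour) →
    (∀ x y → T (arc D x y) → T (colourArc (f x) (f y))) → Hom D target
  hom-target f f-hom = pack ∘ f , λ x y x→y →
    subst₂ (λ p q → T (colourArc p q))
      (≡-sym (unpack-pack (f x))) (≡-sym (unpack-pack (f y)))
      (f-hom x y x→y)

module LexColouring {a n k cH} (G : Graph a) (H : Graph n)
  {c : Fin a → Fin (ℕ.suc k)} (c-proper : ProperColouring (square G) c)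
  {TH : OrientedGraph cH} (homH : (O : Orientation H) → Hom (dir O) TH)
  (O : Orientation (lex G H)) where

  open Target {k} {n} TH

  D : OrientedGraph (a * n)
  D = dir O

  NeighbourOfColour : Fin a → Fin (ℕ.suc k) → Set
  NeighbourOfColour u j = ∃ λ v → T (adj G u v) × c v ≡ j

  neighbourOfColour? : ∀ u j → Dec (NeighbourOfColour u j)
  neighbourOfColour? u j = any? (λ v → T? (adj G u v) ×-dec (c v ≟ j))

  outArcs : ∀ u → Fin n → ∀ {j} → Dec (NeighbourOfColour u j) → Fin (2 ^ n)
  outArcs u w (yes (v , _)) = encodeSubset λ w' → arc D (combine u w) (combine v w')
  outArcs u w (no _) = encodeSubset {n} (const false)  -- never consulted

  ∈ᶜ-outArcs : ∀ {u v} w w' → T (adj G u v) →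
    w' ∈ᶜ outArcs u w (neighbourOfColour? u (c v)) ≡ arc D (combine u w) (combine v w')
  ∈ᶜ-outArcs {u} {v} w w' u~v with neighbourOfColour? u (c v)
  ... | no none = ⊥-elim (none (v , u~v , refl))
  ... | yes (v₀ , u~v₀ , cv₀≡cv)
    with square-proper⇒neighbours-distinct G c-proper u~v₀ u~v cv₀≡cv
  ...   | refl = ∈ᶜ-encodeSubset _ w'

  slot : Fin a → Fin n → Fin (ℕ.suc k) → Slot n
  slot u w j with j <? c u
  ... | yes _ = inj₁ w
  ... | no _ = inj₂ (outArcs u w (neighbourOfColour? u j))

  slot-below : ∀ u w {j} → j < c u → slot u w j ≡ inj₁ w
  slot-below u w {j} j<cu with j <? c u
  ... | yes _ = refl
  ... | no j≮cu = ⊥-elim (j≮cu j<cu)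

  slot-above : ∀ u w {j} → ¬ j < c u →
    slot u w j ≡ inj₂ (outArcs u w (neighbourOfColour? u j))
  slot-above u w {j} j≮cu with j <? c u
  ... | yes j<cu = ⊥-elim (j≮cu j<cu)
  ... | no _ = refl

  slots : Fin a → Fin n → Fin k → Fin (n + 2 ^ n)
  slots u w p = join n (2 ^ n) (slot u w (punchIn (c u) p))

  colour : Fin a → Fin n → Colour
  colour u w = ((c u , funToFin (slots u w)) , proj₁ (homH (fibre G H O u)) w)

  slotFor-slots : ∀ u w {j} (cu≢j : c u ≢ j) →
    slotFor cu≢j (funToFin (slots u w)) ≡ slot u w j
  slotFor-slots u w {j} cu≢j = begin
    splitAt n (finToFun (funToFin (slots u w)) (punchOut cu≢j))
      ≡⟨ cong (splitAt n) (finToFun-funToFin (slots u w) _) ⟩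
    splitAt n (join n (2 ^ n) (slot u w (punchIn (c u) (punchOut cu≢j))))
      ≡⟨ splitAt-join n (2 ^ n) _ ⟩
    slot u w (punchIn (c u) (punchOut cu≢j))
      ≡⟨ cong (slot u w) (punchIn-punchOut cu≢j) ⟩
    slot u w j ∎
    where open ≡-Reasoning

  cross-slots : ∀ {u v} w w' → T (adj G u v) → T (arc D (combine u w) (combine v w')) →
    T (cross (slot u w (c v)) (slot v w' (c u)))
  cross-slots {u} {v} w w' u~v uw→vw' with <-cmp (c u) (c v)
  ... | tri< cu<cv _ cv≮cu rewrite slot-above u w cv≮cu | slot-below v w' cu<cv =
    subst T (≡-sym (∈ᶜ-outArcs w w' u~v)) uw→vw'
  ... | tri≈ _ cu≡cv _ = ⊥-elim (square-proper⇒proper G c-proper u~v cu≡cv)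
  ... | tri> cu≮cv _ cv<cu
    rewrite slot-below u w cv<cu | slot-above v w' cu≮cv
          | ∈ᶜ-outArcs w' w (subst T (sym G u v) u~v) | asym D _ _ uw→vw' = _

  colour-arc : ∀ u w v w' → T (arc D (combine u w) (combine v w')) →
    T (colourArc (colour u w) (colour v w'))
  colour-arc u w v w' uw→vw'
    with lex-adj'⇒adj⊎≡ G H (subst T (lex-adj-combine G H u w v w') (arc⇒edge O _ _ uw→vw'))
  ... | inj₂ refl =
    subst T (≡-sym (colourArc-same (c u) _ _ _ _)) (proj₂ (homH (fibre G H O u)) w w' uw→vw')
  ... | inj₁ u~v =
    subst T (≡-sym (colourArc-distinct cu≢cv (≢-sym cu≢cv) _ _ _ _))
      (subst₂ (λ s s' → T (cross s s')) (≡-sym (slotFor-slots u w cu≢cv))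
        (≡-sym (slotFor-slots v w' (≢-sym cu≢cv))) (cross-slots w w' u~v uw→vw'))
    where
    cu≢cv : c u ≢ c v
    cu≢cv = square-proper⇒proper G c-proper u~v

  lex-hom : Hom D target
  lex-hom = hom-target {D = D} (uncurry colour ∘ remQuot {a} n) λ x y x→y →
    colour-arc _ _ _ _ (subst₂ (λ p q → T (arc D p q))
      (≡-sym (combine-remQuot {a} n x)) (≡-sym (combine-remQuot {a} n y)) x→y)

lex-upperOrientedColourable : ∀ {a n k cH} (G : Graph a) (H : Graph n) →
  Colourable (square G) k → UpperOrientedColourable H cH →
  UpperOrientedColourable (lex G H) (k * (n + 2 ^ n) ^ (k ∸ 1) * cH)
lex-upperOrientedColourable {n = n} {k = ℕ.zero} G H (c , _) _ =
  vertexless⇒upperOrientedColourable (lex G H) (c ∘ proj₁ ∘ remQuot n)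
lex-upperOrientedColourable {n = n} {k = ℕ.suc k} G H (c , c-proper) (TH , homH) =
  Target.target {k} {n} TH , LexColouring.lex-hom {k = k} G H c-proper homH

theorem6 : ∀ {a n : ℕ} (G : Graph a) (H : Graph n) (k cH cGH : ℕ) →
    IsChromaticNumber (square G) k →
    IsUpperOrientedChromaticNumber H cH →
    IsUpperOrientedChromaticNumber (lex G H) cGH →
    cGH ≤ k * (n + 2 ^ n) ^ (k ∸ 1) * cH
theorem6 G H k cH cGH (G²-colourable , _) (H-colourable , _) (_ , cGH-minimal) =
  ≮⇒≥ λ bound<cGH →
    cGH-minimal _ bound<cGH (lex-upperOrientedColourable G H G²-colourable H-colourable)
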